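{- Let $Q$ be a positive integer, let $x$ be the least common multiple of $1,2,\dots,Q$, and let $X=(X_{mn})_{m,n=1}^x$ with $X_{mn}=\sum_{q=1}^Q c_q(m-n)$. Then for every integer $j\ge 2$, $X^j=x^{j-1}X$.
   Context: For a positive integer $q$ and any integer $n$, the Ramanujan sum is $c_q(n)=\sum_{1\le k\le q,\ \gcd(k,q)=1}\exp(2\pi i kn/q)$. -}

module Defs where

open import Level using (Level)
open import Algebra.Bundles using (CommutativeRing)
open import Data.Nat as ℕ using (ℕ; zero; suc; _∸_; _≡ᵇ_; _<_)
open import Data.Nat.GCD using (gcd)
open import Data.Nat.LCM using (lcm)
open import Data.Integer as ℤ using (ℤ; +_; _%ℕ_)
open import Data.Fin using (Fin; toℕ)
open import Data.Bool using (if_then_else_)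
open import Data.Sum using (_⊎_)
open import Relation.Nullary using (¬_; does)
import Data.Fin

lcmUpTo : ℕ → ℕ
lcmUpTo zero    = 1
lcmUpTo (suc n) = lcm (suc n) (lcmUpTo n)

module _ {c ℓ : Level} (R : CommutativeRing c ℓ) where
  open CommutativeRing R

  pow : Carrier → ℕ → Carrier
  pow a zero    = 1#
  pow a (suc n) = a * pow a n

  natR : ℕ → Carrier
  natR zero    = 0#
  natR (suc n) = 1# + natR n

  IsIntegralDomain : Set (c Level.⊔ ℓ)
  IsIntegralDomain = (¬ (1# ≈ 0#)) × ((a b : Carrier) → a * b ≈ 0# → (a ≈ 0#) ⊎ (b ≈ 0#))
    where open import Data.Product using (_×_)

  IsPrimitiveRoot : ℕ → Carrier → Set ℓ
  IsPrimitiveRoot N ζ = (pow ζ N ≈ 1#) × ((d : ℕ) → 0 < d → d < N → ¬ (pow ζ d ≈ 1#))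
    where open import Data.Product using (_×_)

  -- ζ^a for an integer exponent a, where ζ has order dividing N ≥ 1
  -- (exponent reduced mod N; the N = 0 clause is never used)
  zpow : ℕ → Carrier → ℤ → Carrier
  zpow zero    ζ a = 1#
  zpow (suc n) ζ a = pow ζ (a %ℕ suc n)

  sumℕ : ℕ → (ℕ → Carrier) → Carrier
  sumℕ zero    f = 0#
  sumℕ (suc n) f = sumℕ n f + f n

  sumFin : (n : ℕ) → (Fin n → Carrier) → Carrier
  sumFin zero    f = 0#
  sumFin (suc n) f = f Data.Fin.zero + sumFin n (λ i → f (Data.Fin.suc i))

  -- Ramanujan sum c_q(n) = Σ_{1≤k≤q, gcd(k,q)=1} exp(2πi k n / q),
  -- realised with ζ = exp(2πi/N) a primitive N-th root of unity and q ∣ N: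
  -- exp(2πi k n / q) = ζ^(k n (N/q)).
  ramanujan : (N : ℕ) (ζ : Carrier) (q : ℕ) .{{_ : ℕ.NonZero q}} → ℤ → Carrier
  ramanujan N ζ q n =
    sumℕ q (λ k → if gcd (suc k) q ≡ᵇ 1
                   then zpow N ζ (+ (suc k ℕ.* (N ℕ./ q)) ℤ.* n)
                   else 0#)

  Matrix : ℕ → Set c
  Matrix N = Fin N → Fin N → Carrier

  _·_ : {N : ℕ} → Matrix N → Matrix N → Matrix N
  _·_ {N} A B m n = sumFin N (λ l → A m l * B l n)

  identity : {N : ℕ} → Matrix N
  identity m n = if does (m Data.Fin.≟ n) then 1# else 0#

  mpow : {N : ℕ} → Matrix N → ℕ → Matrix N
  mpow A zero    = identity
  mpow A (suc j) = A · mpow A j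

  -- X_{mn} = Σ_{q=1}^{Q} c_q(m - n), an x × x matrix with x = lcm(1..Q)
  -- (rows/columns indexed by Fin x, i.e. 0..x-1 instead of 1..x; only m - n matters)
  Xmat : (Q : ℕ) → Carrier → Matrix (lcmUpTo Q)
  Xmat Q ζ m n = sumℕ Q (λ i → ramanujan (lcmUpTo Q) ζ (suc i)
                                  (+ toℕ m ℤ.- + toℕ n))

module Submission where

-- Index the terms of Σ_{q ≤ Q} c_q(m - n) by the reduced fractions k/q, 1 ≤ k ≤ q ≤ Q. The term of k/q is
-- ζ^(e (m - n)) with e = k·(x/q), so X is a sum of rank-one matrices χ_e χ̄_eᵀ, where χ_e(m) = ζ^(e m) and
-- χ̄_e(n) = ζ^(-e n). A reduced fraction is determined by its value, so these exponents are distinct elements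
-- of [1, x], hence pairwise incongruent modulo x. As ζ is a primitive x-th root of unity in a domain, the
-- characters are orthogonal: ⟨χ̄_e, χ_e′⟩ = x if e ≡ e′ (mod x) and 0 otherwise. Hence X² = x X, and
-- X^j = x^(j-1) X follows by induction on j.

open import Defs
open import Level using (Level)
open import Algebra.Bundles using (CommutativeRing)
open import Data.Nat as ℕ using (ℕ; zero; suc; _≤_; _<_; _∸_; _≡ᵇ_; _/_; z<s; s≤s)
import Data.Nat.Properties as ℕ
open import Data.Nat.Divisibility using (_∣_; divides; ∣⇒≤; ∣-trans; ∣m+n∣m⇒∣n; ∣-antisym; >⇒∤; m%n≡0⇒n∣m)
open import Data.Nat.DivMod using (_%_; m/n*n≡m; m*[n/m]≡n; m≥n⇒m/n>0; m≡m%n+[m/n]*n; m%n<n)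
import Data.Nat.Tactic.RingSolver as ℕ-Solver
open import Data.Nat.GCD using (gcd)
open import Data.Nat.LCM using (m∣lcm[m,n]; n∣lcm[m,n])
open import Data.Nat.Coprimality using (Coprime; coprime-divisor; gcd≡1⇒coprime)
import Data.Nat.Coprimality as Coprime
open import Data.Integer as ℤ using (+_; -[1+_]; _%ℕ_; _/ℕ_)
import Data.Integer.Properties as ℤ
open import Data.Integer.DivMod using (a≡a%ℕn+[a/ℕn]*n)
import Data.Integer.Tactic.RingSolver as ℤ-Solver
open import Data.Fin as Fin using (Fin; toℕ)
import Data.Fin.Properties as Fin
open import Data.Product using (Σ; _×_; _,_; proj₁; proj₂)
open import Data.Product.Properties using (,-injectiveˡ)
open import Function using (_∘_; id)
open import Data.Sum using (inj₁; inj₂; [_,_]′)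
open import Data.Bool using (Bool; true; false; if_then_else_; T)
open import Relation.Nullary using (¬_; contradiction; yes; no)
open import Relation.Binary.PropositionalEquality as ≡ using (_≡_; _≢_)

∣m+n∣m+o⇒n≤o⇒n≡o : ∀ {d m n o} → 0 < n → o ≤ d → n ≤ o → d ∣ m ℕ.+ n → d ∣ m ℕ.+ o → n ≡ o
∣m+n∣m+o⇒n≤o⇒n≡o {d} {m} {n} {o} 0<n o≤d n≤o d∣m+n d∣m+o =
  ℕ.≤-antisym n≤o (ℕ.m∸n≡0⇒m≤n (gap≡0 (o ∸ n) d∣gap gap<d))
  where
  m+o≡m+n+gap : m ℕ.+ o ≡ m ℕ.+ n ℕ.+ (o ∸ n)
  m+o≡m+n+gap = ≡.trans (≡.cong (m ℕ.+_) (≡.sym (ℕ.m+[n∸m]≡n n≤o))) (≡.sym (ℕ.+-assoc m n _))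
  d∣gap : d ∣ o ∸ n
  d∣gap = ∣m+n∣m⇒∣n (≡.subst (d ∣_) m+o≡m+n+gap d∣m+o) d∣m+n
  gap<d : o ∸ n < d
  gap<d = ℕ.≤-trans (ℕ.∸-monoʳ-< 0<n n≤o) o≤d
  gap≡0 : ∀ k → d ∣ k → k < d → k ≡ 0
  gap≡0 zero    _   _   = ≡.refl
  gap≡0 (suc k) d∣k k<d = contradiction d∣k (>⇒∤ k<d)

∣m+n∣m+o⇒n≡o : ∀ {d m n o} → 0 < n → n ≤ d → 0 < o → o ≤ d → d ∣ m ℕ.+ n → d ∣ m ℕ.+ o → n ≡ o
∣m+n∣m+o⇒n≡o 0<n n≤d 0<o o≤d d∣m+n d∣m+o with ℕ.≤-total _ _
... | inj₁ n≤o = ∣m+n∣m+o⇒n≤o⇒n≡o 0<n o≤d n≤o d∣m+n d∣m+o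
... | inj₂ o≤n = ≡.sym (∣m+n∣m+o⇒n≤o⇒n≡o 0<o n≤d o≤n d∣m+o d∣m+n)

reduced-fraction-unique : ∀ {k q k′ q′} .{{_ : ℕ.NonZero q}} → Coprime k q → Coprime k′ q′ →
  k ℕ.* q′ ≡ k′ ℕ.* q → q ≡ q′ × k ≡ k′
reduced-fraction-unique {k} {q} {k′} {q′} k⊥q k′⊥q′ kq′≡k′q = q≡q′ , k≡k′
  where
  q≡q′ : q ≡ q′
  q≡q′ = ∣-antisym (coprime-divisor (Coprime.sym k⊥q) (divides k′ kq′≡k′q))
                   (coprime-divisor (Coprime.sym k′⊥q′) (divides k (≡.sym kq′≡k′q)))
  k≡k′ : k ≡ k′
  k≡k′ = ℕ.*-cancelʳ-≡ k k′ q (≡.trans (≡.cong (k ℕ.*_) q≡q′) kq′≡k′q)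

module _ {N q : ℕ} .{{_ : ℕ.NonZero N}} .{{_ : ℕ.NonZero q}} (q∣N : q ∣ N) where

  0<*[/] : ∀ {k} → 0 < k → 0 < k ℕ.* (N / q)
  0<*[/] 0<k = ℕ.*-mono-≤ 0<k (m≥n⇒m/n>0 (∣⇒≤ q∣N))

  *[/]≤ : ∀ {k} → k ≤ q → k ℕ.* (N / q) ≤ N
  *[/]≤ k≤q = ℕ.≤-trans (ℕ.*-monoˡ-≤ (N / q) k≤q) (ℕ.≤-reflexive (m*[n/m]≡n q∣N))

*[/]-reduced-injective : ∀ {N k q k′ q′} .{{_ : ℕ.NonZero N}} .{{_ : ℕ.NonZero q}} .{{_ : ℕ.NonZero q′}} →
  q ∣ N → q′ ∣ N → Coprime k q → Coprime k′ q′ → k ℕ.* (N / q) ≡ k′ ℕ.* (N / q′) → q ≡ q′ × k ≡ k′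
*[/]-reduced-injective {N} {k} {q} {k′} {q′} q∣N q′∣N k⊥q k′⊥q′ eq =
  reduced-fraction-unique k⊥q k′⊥q′ (ℕ.*-cancelʳ-≡ (k ℕ.* q′) (k′ ℕ.* q) N (begin
    k ℕ.* q′ ℕ.* N                       ≡⟨ ≡.cong (k ℕ.* q′ ℕ.*_) (≡.sym (m/n*n≡m q∣N)) ⟩
    k ℕ.* q′ ℕ.* (N / q ℕ.* q)           ≡⟨ regroup k q′ (N / q) q ⟩
    k ℕ.* (N / q) ℕ.* (q ℕ.* q′)         ≡⟨ ≡.cong₂ ℕ._*_ eq (ℕ.*-comm q q′) ⟩
    k′ ℕ.* (N / q′) ℕ.* (q′ ℕ.* q)       ≡⟨ ≡.sym (regroup k′ q (N / q′) q′) ⟩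
    k′ ℕ.* q ℕ.* (N / q′ ℕ.* q′)         ≡⟨ ≡.cong (k′ ℕ.* q ℕ.*_) (m/n*n≡m q′∣N) ⟩
    k′ ℕ.* q ℕ.* N                       ∎))
  where
  open ≡.≡-Reasoning
  regroup : ∀ k q′ a q → k ℕ.* q′ ℕ.* (a ℕ.* q) ≡ k ℕ.* a ℕ.* (q ℕ.* q′)
  regroup = ℕ-Solver.solve-∀

exponent-congruence : ∀ e m n N′ → let z = + e ℤ.* (+ m ℤ.- + n) in
  + (e ℕ.* m ℕ.+ e ℕ.* (N′ ℕ.* n)) ≡ + (z %ℕ suc N′) ℤ.+ (z /ℕ suc N′ ℤ.+ + (e ℕ.* n)) ℤ.* + suc N′
exponent-congruence e m n N′ = begin
  + (e ℕ.* m ℕ.+ e ℕ.* (N′ ℕ.* n))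
    ≡⟨ ℤ.pos-+ (e ℕ.* m) _ ⟩
  + (e ℕ.* m) ℤ.+ + (e ℕ.* (N′ ℕ.* n))
    ≡⟨ ≡.cong₂ ℤ._+_ (ℤ.pos-* e m) (≡.trans (ℤ.pos-* e _) (≡.cong (+ e ℤ.*_) (ℤ.pos-* N′ n))) ⟩
  + e ℤ.* + m ℤ.+ + e ℤ.* (+ N′ ℤ.* + n)
    ≡⟨ expand (+ e) (+ m) (+ n) (+ N′) ⟩
  z ℤ.+ + e ℤ.* + n ℤ.* (+ 1 ℤ.+ + N′)
    ≡⟨ ≡.cong₂ (λ x y → x ℤ.+ y ℤ.* (+ 1 ℤ.+ + N′)) (a≡a%ℕn+[a/ℕn]*n z (suc N′)) (≡.sym (ℤ.pos-* e n)) ⟩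
  (+ (z %ℕ suc N′) ℤ.+ z /ℕ suc N′ ℤ.* + suc N′) ℤ.+ + (e ℕ.* n) ℤ.* + suc N′
    ≡⟨ regroup (+ (z %ℕ suc N′)) (z /ℕ suc N′) (+ (e ℕ.* n)) (+ suc N′) ⟩
  + (z %ℕ suc N′) ℤ.+ (z /ℕ suc N′ ℤ.+ + (e ℕ.* n)) ℤ.* + suc N′ ∎
  where
  open ≡.≡-Reasoning
  z = + e ℤ.* (+ m ℤ.- + n)
  expand : ∀ e m n N′ → e ℤ.* m ℤ.+ e ℤ.* (N′ ℤ.* n) ≡ e ℤ.* (m ℤ.- n) ℤ.+ e ℤ.* n ℤ.* (+ 1 ℤ.+ N′)
  expand = ℤ-Solver.solve-∀
  regroup : ∀ r q y N → (r ℤ.+ q ℤ.* N) ℤ.+ y ℤ.* N ≡ r ℤ.+ (q ℤ.+ y) ℤ.* N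
  regroup = ℤ-Solver.solve-∀

module _ {c ℓ : Level} (R : CommutativeRing c ℓ) where
  open CommutativeRing R
  open import Algebra.Properties.Semiring.Sum semiring
  open import Relation.Binary.Reasoning.Setoid setoid
  open import Algebra.Properties.CommutativeSemigroup *-commutativeSemigroup using (x∙yz≈y∙xz)
  open import Algebra.Properties.Semiring.Exp semiring using (_^_; ^-homo-*; ^-assocʳ; ^-congˡ)
  open import Algebra.Properties.Ring ring using ([y-z]x≈yx-zx)
  open import Algebra.Properties.Group +-group using (∙-cancelʳ; x∙y⁻¹≈ε⇒x≈y; x≈y⇒x∙y⁻¹≈ε)
  open import Algebra.Solver.CommutativeMonoid *-commutativeMonoid using (solve; _⊜_; _⊕_)

  sumFin≡∑ : ∀ n (f : Fin n → Carrier) → sumFin R n f ≡ ∑[ i < n ] f i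
  sumFin≡∑ zero    f = ≡.refl
  sumFin≡∑ (suc n) f = ≡.cong (λ x → f Fin.zero + x) (sumFin≡∑ n (f ∘ Fin.suc))

  ∑-init-last-toℕ : ∀ n (f : ℕ → Carrier) → ∑[ i < suc n ] f (toℕ i) ≈ ∑[ i < n ] f (toℕ i) + f n
  ∑-init-last-toℕ n f = begin
    ∑[ i < suc n ] f (toℕ i)
      ≈⟨ sum-init-last (f ∘ toℕ) ⟩
    ∑[ i < n ] f (toℕ (Fin.inject₁ i)) + f (toℕ (Fin.fromℕ n))
      ≡⟨ ≡.cong₂ _+_ (sum-cong-≗ {n} (≡.cong f ∘ Fin.toℕ-inject₁)) (≡.cong f (Fin.toℕ-fromℕ n)) ⟩
    ∑[ i < n ] f (toℕ i) + f n ∎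

  sumℕ≈∑ : ∀ n (f : ℕ → Carrier) → sumℕ R n f ≈ ∑[ i < n ] f (toℕ i)
  sumℕ≈∑ zero    f = refl
  sumℕ≈∑ (suc n) f = trans (+-congʳ (sumℕ≈∑ n f)) (sym (∑-init-last-toℕ n f))

  ∑-zero : ∀ {n} {f : Fin n → Carrier} → (∀ i → f i ≈ 0#) → ∑[ i < n ] f i ≈ 0#
  ∑-zero {n} f≈0 = trans (sum-cong-≋ f≈0) (sum-replicate-zero n)

  ∑-collapse : ∀ {n} {f : Fin n → Carrier} i → (∀ j → j ≢ i → f j ≈ 0#) → ∑[ j < n ] f j ≈ f i
  ∑-collapse {suc n} {f} i f≈0 = begin
    ∑[ j < suc n ] f j                   ≈⟨ sum-remove f ⟩
    f i + ∑[ j < n ] f (Fin.punchIn i j) ≈⟨ +-congˡ (∑-zero (λ j → f≈0 _ (Fin.punchInᵢ≢i i j))) ⟩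
    f i + 0#                             ≈⟨ +-identityʳ (f i) ⟩
    f i                                  ∎

  ∑1≈natR : ∀ n → ∑[ l < n ] 1# ≈ natR R n
  ∑1≈natR zero    = refl
  ∑1≈natR (suc n) = +-congˡ (∑1≈natR n)

  module PairSum {Q : ℕ} (size : Fin Q → ℕ) where

    Pair : Set
    Pair = Σ (Fin Q) (Fin ∘ size)

    ∑ᴾ : (Pair → Carrier) → Carrier
    ∑ᴾ f = ∑[ i < Q ] ∑[ k < size i ] f (i , k)

    ∑ᴾ-cong : ∀ {f g : Pair → Carrier} → (∀ p → f p ≈ g p) → ∑ᴾ f ≈ ∑ᴾ g
    ∑ᴾ-cong f≈g = sum-cong-≋ (λ i → sum-cong-≋ (λ k → f≈g (i , k)))

    *-distribˡ-∑ᴾ : ∀ x (f : Pair → Carrier) → x * ∑ᴾ f ≈ ∑ᴾ (λ p → x * f p)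
    *-distribˡ-∑ᴾ x f = trans (*-distribˡ-sum {Q} x _) (sum-cong-≋ (λ i → *-distribˡ-sum {size i} x _))

    *-distribʳ-∑ᴾ : ∀ x (f : Pair → Carrier) → ∑ᴾ f * x ≈ ∑ᴾ (λ p → f p * x)
    *-distribʳ-∑ᴾ x f = trans (*-distribʳ-sum {Q} x _) (sum-cong-≋ (λ i → *-distribʳ-sum {size i} x _))

    ∑-∑ᴾ-comm : ∀ {n} (f : Fin n → Pair → Carrier) → ∑[ l < n ] ∑ᴾ (f l) ≈ ∑ᴾ (λ p → ∑[ l < n ] f l p)
    ∑-∑ᴾ-comm {n} f = trans (∑-comm {n} {Q} _) (sum-cong-≋ (λ i → ∑-comm {n} {size i} _))

    ∑ᴾ-collapse : ∀ {f : Pair → Carrier} p → (∀ p′ → p′ ≢ p → f p′ ≈ 0#) → ∑ᴾ f ≈ f p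
    ∑ᴾ-collapse (i , k) f≈0 = trans
      (∑-collapse i (λ i′ i′≢i → ∑-zero (λ k′ → f≈0 (i′ , k′) (i′≢i ∘ ,-injectiveˡ))))
      (∑-collapse k (λ k′ k′≢k → f≈0 (i , k′) (k′≢k ∘ Fin.toℕ-injective ∘ ≡.cong (toℕ ∘ proj₂))))

  ·≡∑ : ∀ {N} (A B : Matrix R N) m n → (_·_ R A B) m n ≡ ∑[ l < N ] (A m l * B l n)
  ·≡∑ {N} A B m n = sumFin≡∑ N _

  ·-cong : ∀ {N} {A A′ B B′ : Matrix R N} → (∀ m n → A m n ≈ A′ m n) → (∀ m n → B m n ≈ B′ m n) →
           ∀ m n → (_·_ R A B) m n ≈ (_·_ R A′ B′) m n
  ·-cong {N} {A} {A′} {B} {B′} A≈A′ B≈B′ m n = begin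
    (_·_ R A B) m n                 ≡⟨ ·≡∑ A B m n ⟩
    ∑[ l < N ] (A m l * B l n)      ≈⟨ sum-cong-≋ {N} (λ l → *-cong (A≈A′ m l) (B≈B′ l n)) ⟩
    ∑[ l < N ] (A′ m l * B′ l n)    ≡⟨ ≡.sym (·≡∑ A′ B′ m n) ⟩
    (_·_ R A′ B′) m n               ∎

  ·-identityʳ : ∀ {N} (A : Matrix R N) m n → (_·_ R A (identity R)) m n ≈ A m n
  ·-identityʳ {N} A m n = begin
    (_·_ R A (identity R)) m n           ≡⟨ ·≡∑ A (identity R) m n ⟩
    ∑[ l < N ] (A m l * identity R l n)  ≈⟨ ∑-collapse n (λ l l≢n → trans (*-congˡ (off-diagonal l≢n)) (zeroʳ _)) ⟩
    A m n * identity R n n               ≈⟨ trans (*-congˡ diagonal) (*-identityʳ _) ⟩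
    A m n                                ∎
    where
    off-diagonal : ∀ {l} → l ≢ n → identity R l n ≈ 0#
    off-diagonal {l} l≢n with l Fin.≟ n
    ... | yes l≡n = contradiction l≡n l≢n
    ... | no  _   = refl
    diagonal : identity R n n ≈ 1#
    diagonal with n Fin.≟ n
    ... | yes _   = refl
    ... | no  n≢n = contradiction ≡.refl n≢n

  mpow-suc : ∀ {N} (A : Matrix R N) s → (∀ m n → (_·_ R A A) m n ≈ s * A m n) →
             ∀ j m n → mpow R A (suc j) m n ≈ pow R s j * A m n
  mpow-suc A s A²≈sA zero    m n = trans (·-identityʳ A m n) (sym (*-identityˡ _))
  mpow-suc {N} A s A²≈sA (suc j) m n = begin
    mpow R A (suc (suc j)) m n                 ≡⟨ ·≡∑ A (mpow R A (suc j)) m n ⟩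
    ∑[ l < N ] (A m l * mpow R A (suc j) l n)  ≈⟨ sum-cong-≋ {N} (λ l → *-congˡ (mpow-suc A s A²≈sA j l n)) ⟩
    ∑[ l < N ] (A m l * (sⱼ * A l n))          ≈⟨ sum-cong-≋ {N} (λ l → x∙yz≈y∙xz _ _ _) ⟩
    ∑[ l < N ] (sⱼ * (A m l * A l n))          ≈⟨ sym (*-distribˡ-sum {N} sⱼ _) ⟩
    sⱼ * ∑[ l < N ] (A m l * A l n)            ≡⟨ ≡.cong (sⱼ *_) (≡.sym (·≡∑ A A m n)) ⟩
    sⱼ * (_·_ R A A) m n                       ≈⟨ *-congˡ (A²≈sA m n) ⟩
    sⱼ * (s * A m n)                           ≈⟨ x∙yz≈y∙xz _ _ _ ⟩
    s * (sⱼ * A m n)                           ≈⟨ sym (*-assoc _ _ _) ⟩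
    pow R s (suc j) * A m n                    ∎
    where sⱼ = pow R s j

  ⟨_,_⟩ : ∀ {N} → (Fin N → Carrier) → (Fin N → Carrier) → Carrier
  ⟨_,_⟩ {N} x y = ∑[ l < N ] (x l * y l)

  ⟦_⟧ : Bool → Carrier
  ⟦ b ⟧ = if b then 1# else 0#

  if≈⟦⟧* : ∀ b x → (if b then x else 0#) ≈ ⟦ b ⟧ * x
  if≈⟦⟧* true  x = sym (*-identityˡ x)
  if≈⟦⟧* false x = sym (zeroˡ x)

  ⟦⟧*⟦⟧*≈0 : ∀ b b′ {g} → (T b → T b′ → g ≈ 0#) → ⟦ b ⟧ * ⟦ b′ ⟧ * g ≈ 0#
  ⟦⟧*⟦⟧*≈0 true  true  g≈0 = trans (*-congˡ (g≈0 _ _)) (zeroʳ _)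
  ⟦⟧*⟦⟧*≈0 true  false _   = trans (*-congʳ (zeroʳ _)) (zeroˡ _)
  ⟦⟧*⟦⟧*≈0 false _     _   = trans (*-congʳ (zeroˡ _)) (zeroˡ _)

  ⟦⟧*⟦⟧*≈⟦⟧* : ∀ b {g s} → (T b → g ≈ s) → ⟦ b ⟧ * ⟦ b ⟧ * g ≈ ⟦ b ⟧ * s
  ⟦⟧*⟦⟧*≈⟦⟧* true  g≈s = trans (*-congʳ (*-identityˡ 1#)) (*-congˡ (g≈s _))
  ⟦⟧*⟦⟧*≈⟦⟧* false _   = trans (*-congʳ (zeroˡ _)) (trans (zeroˡ _) (sym (zeroˡ _)))

  module OuterSum {Q : ℕ} (size : Fin Q → ℕ) {N : ℕ} (b : PairSum.Pair size → Bool)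
                  (u v : PairSum.Pair size → Fin N → Carrier) where
    open PairSum size

    outerSum : Matrix R N
    outerSum m n = ∑ᴾ (λ p → if b p then u p m * v p n else 0#)

    outerSum-square : ∀ s → (∀ p p′ → T (b p) → T (b p′) → p ≢ p′ → ⟨ v p , u p′ ⟩ ≈ 0#) →
                      (∀ p → T (b p) → ⟨ v p , u p ⟩ ≈ s) →
                      ∀ m n → (_·_ R outerSum outerSum) m n ≈ s * outerSum m n
    outerSum-square s orthogonal normalised m n = begin
      (_·_ R outerSum outerSum) m n
        ≡⟨ ·≡∑ outerSum outerSum m n ⟩
      ∑[ l < N ] (outerSum m l * outerSum l n)
        ≈⟨ sum-cong-≋ {N} (λ l → *-cong (weighted m l) (weighted l n)) ⟩
      ∑[ l < N ] (∑ᴾ (λ p → w p * (u p m * v p l)) * ∑ᴾ (λ p′ → w p′ * (u p′ l * v p′ n)))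
        ≈⟨ sum-cong-≋ {N} (λ l → trans (*-distribʳ-∑ᴾ _ _) (∑ᴾ-cong (λ p → *-distribˡ-∑ᴾ _ _))) ⟩
      ∑[ l < N ] ∑ᴾ (λ p → ∑ᴾ (λ p′ → (w p * (u p m * v p l)) * (w p′ * (u p′ l * v p′ n))))
        ≈⟨ trans (∑-∑ᴾ-comm {N} _) (∑ᴾ-cong (λ p → ∑-∑ᴾ-comm {N} _)) ⟩
      ∑ᴾ (λ p → ∑ᴾ (λ p′ → ∑[ l < N ] ((w p * (u p m * v p l)) * (w p′ * (u p′ l * v p′ n)))))
        ≈⟨ ∑ᴾ-cong (λ p → ∑ᴾ-cong (λ p′ → gram p p′)) ⟩
      ∑ᴾ (λ p → ∑ᴾ (λ p′ → (u p m * v p′ n) * (w p * w p′ * ⟨ v p , u p′ ⟩)))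
        ≈⟨ ∑ᴾ-cong (λ p → ∑ᴾ-collapse p (off-diagonal p)) ⟩
      ∑ᴾ (λ p → (u p m * v p n) * (w p * w p * ⟨ v p , u p ⟩))
        ≈⟨ ∑ᴾ-cong (λ p → trans (*-congˡ (⟦⟧*⟦⟧*≈⟦⟧* (b p) (normalised p))) (rotate _ _ _)) ⟩
      ∑ᴾ (λ p → s * (w p * (u p m * v p n)))
        ≈⟨ sym (*-distribˡ-∑ᴾ s _) ⟩
      s * ∑ᴾ (λ p → w p * (u p m * v p n))
        ≈⟨ *-congˡ (sym (weighted m n)) ⟩
      s * outerSum m n ∎
      where
      w : Pair → Carrier
      w p = ⟦ b p ⟧
      weighted : ∀ m n → outerSum m n ≈ ∑ᴾ (λ p → w p * (u p m * v p n))
      weighted m n = ∑ᴾ-cong (λ p → if≈⟦⟧* (b p) _)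
      regroup : ∀ w a x w′ y b → (w * (a * x)) * (w′ * (y * b)) ≈ (a * b) * (w * w′) * (x * y)
      regroup = solve 6 (λ w a x w′ y b → (w ⊕ (a ⊕ x)) ⊕ (w′ ⊕ (y ⊕ b))
                                        ⊜ ((a ⊕ b) ⊕ (w ⊕ w′)) ⊕ (x ⊕ y)) refl
      rotate : ∀ a w s → a * (w * s) ≈ s * (w * a)
      rotate = solve 3 (λ a w s → a ⊕ (w ⊕ s) ⊜ s ⊕ (w ⊕ a)) refl
      off-diagonal : ∀ p p′ → p′ ≢ p → (u p m * v p′ n) * (w p * w p′ * ⟨ v p , u p′ ⟩) ≈ 0#
      off-diagonal p p′ p′≢p =
        trans (*-congˡ (⟦⟧*⟦⟧*≈0 (b p) (b p′) (λ bp bp′ → orthogonal p p′ bp bp′ (p′≢p ∘ ≡.sym)))) (zeroʳ _)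
      gram : ∀ p p′ → ∑[ l < N ] ((w p * (u p m * v p l)) * (w p′ * (u p′ l * v p′ n)))
                      ≈ (u p m * v p′ n) * (w p * w p′ * ⟨ v p , u p′ ⟩)
      gram p p′ = begin
        ∑[ l < N ] ((w p * (u p m * v p l)) * (w p′ * (u p′ l * v p′ n)))
          ≈⟨ sum-cong-≋ {N} (λ l → regroup (w p) (u p m) (v p l) (w p′) (u p′ l) (v p′ n)) ⟩
        ∑[ l < N ] ((u p m * v p′ n) * (w p * w p′) * (v p l * u p′ l))
          ≈⟨ sym (*-distribˡ-sum {N} _ _) ⟩
        (u p m * v p′ n) * (w p * w p′) * ⟨ v p , u p′ ⟩
          ≈⟨ *-assoc _ _ _ ⟩
        (u p m * v p′ n) * (w p * w p′ * ⟨ v p , u p′ ⟩) ∎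

  pow≡^ : ∀ x n → pow R x n ≡ x ^ n
  pow≡^ x zero    = ≡.refl
  pow≡^ x (suc n) = ≡.cong (x *_) (pow≡^ x n)

  1^n≈1 : ∀ n → 1# ^ n ≈ 1#
  1^n≈1 zero    = refl
  1^n≈1 (suc n) = trans (*-identityˡ _) (1^n≈1 n)

  geometric-sum : ∀ ρ n → ρ * ∑[ l < n ] (ρ ^ toℕ l) + 1# ≈ ∑[ l < n ] (ρ ^ toℕ l) + ρ ^ n
  geometric-sum ρ n = begin
    ρ * ∑[ l < n ] (ρ ^ toℕ l) + 1#       ≈⟨ +-comm _ _ ⟩
    1# + ρ * ∑[ l < n ] (ρ ^ toℕ l)       ≈⟨ +-congˡ (*-distribˡ-sum {n} ρ _) ⟩
    ∑[ l < suc n ] (ρ ^ toℕ l)            ≈⟨ ∑-init-last-toℕ n (ρ ^_) ⟩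
    ∑[ l < n ] (ρ ^ toℕ l) + ρ ^ n        ∎

  ∑-powers-root-of-unity : IsIntegralDomain R → ∀ {ρ} n → ρ ^ n ≈ 1# → ¬ ρ ≈ 1# → ∑[ l < n ] (ρ ^ toℕ l) ≈ 0#
  ∑-powers-root-of-unity (_ , no-zero-divisors) {ρ} n ρ^n≈1 ρ≉1 =
    [ (λ ρ-1≈0 → contradiction (x∙y⁻¹≈ε⇒x≈y ρ 1# ρ-1≈0) ρ≉1) , id ]′ (no-zero-divisors (ρ - 1#) S [ρ-1]S≈0)
    where
    S = ∑[ l < n ] (ρ ^ toℕ l)
    ρS≈S : ρ * S ≈ S
    ρS≈S = ∙-cancelʳ 1# (ρ * S) S (trans (geometric-sum ρ n) (+-congˡ ρ^n≈1))
    [ρ-1]S≈0 : (ρ - 1#) * S ≈ 0#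
    [ρ-1]S≈0 = trans ([y-z]x≈yx-zx S ρ 1#) (x≈y⇒x∙y⁻¹≈ε (trans ρS≈S (sym (*-identityˡ S))))

  module PrimitiveRoot {N : ℕ} .{{_ : ℕ.NonZero N}} {ζ : Carrier} (ζ-primitive : IsPrimitiveRoot R N ζ) where

    ζ^N≈1 : ζ ^ N ≈ 1#
    ζ^N≈1 = trans (reflexive (≡.sym (pow≡^ ζ N))) (proj₁ ζ-primitive)

    ^-+N* : ∀ a c → ζ ^ (a ℕ.+ N ℕ.* c) ≈ ζ ^ a
    ^-+N* a c = begin
      ζ ^ (a ℕ.+ N ℕ.* c)       ≈⟨ ^-homo-* ζ a _ ⟩
      ζ ^ a * ζ ^ (N ℕ.* c)     ≈⟨ *-congˡ (sym (^-assocʳ ζ N c)) ⟩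
      ζ ^ a * (ζ ^ N) ^ c       ≈⟨ *-congˡ (trans (^-congˡ c ζ^N≈1) (1^n≈1 c)) ⟩
      ζ ^ a * 1#                ≈⟨ *-identityʳ _ ⟩
      ζ ^ a                     ∎

    ζ^[N*c]≈1 : ∀ c → ζ ^ (N ℕ.* c) ≈ 1#
    ζ^[N*c]≈1 = ^-+N* 0

    ^-≡-mod : ∀ a b t → + a ≡ + b ℤ.+ t ℤ.* + N → ζ ^ a ≈ ζ ^ b
    ^-≡-mod a b (+ c) a≡b+cN = begin
      ζ ^ a                  ≡⟨ ≡.cong (ζ ^_) (ℤ.+-injective (≡.trans a≡b+cN (≡.sym cast))) ⟩
      ζ ^ (b ℕ.+ N ℕ.* c)    ≈⟨ ^-+N* b c ⟩
      ζ ^ b                  ∎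
      where
      cast : + (b ℕ.+ N ℕ.* c) ≡ + b ℤ.+ + c ℤ.* + N
      cast = ≡.trans (ℤ.pos-+ b _) (≡.cong (ℤ._+_ (+ b)) (≡.trans (ℤ.pos-* N c) (ℤ.*-comm (+ N) (+ c))))
    ^-≡-mod a b -[1+ c ] a≡b-[1+c]N = sym (begin
      ζ ^ b                        ≡⟨ ≡.cong (ζ ^_) (ℤ.+-injective (≡.sym cast)) ⟩
      ζ ^ (a ℕ.+ N ℕ.* suc c)      ≈⟨ ^-+N* a (suc c) ⟩
      ζ ^ a                        ∎)
      where
      cancel : ∀ b t n → (b ℤ.+ ℤ.- t ℤ.* n) ℤ.+ t ℤ.* n ≡ b
      cancel = ℤ-Solver.solve-∀
      cast : + (a ℕ.+ N ℕ.* suc c) ≡ + b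
      cast = ≡.trans (ℤ.pos-+ a _)
               (≡.trans (≡.cong₂ ℤ._+_ a≡b-[1+c]N (≡.trans (ℤ.pos-* N (suc c)) (ℤ.*-comm (+ N) (+ suc c))))
                        (cancel (+ b) (+ suc c) (+ N)))

    ^≈1⇒∣ : ∀ a → ζ ^ a ≈ 1# → N ∣ a
    ^≈1⇒∣ a ζ^a≈1 with a % N in a%N≡r
    ... | zero  = m%n≡0⇒n∣m a N a%N≡r
    ... | suc r = contradiction ζ^[1+r]≈1 (proj₂ ζ-primitive (suc r) z<s (≡.subst (_< N) a%N≡r (m%n<n a N)))
      where
      a≡a%N+N*a/N : a ≡ a % N ℕ.+ N ℕ.* (a / N)
      a≡a%N+N*a/N = ≡.trans (m≡m%n+[m/n]*n a N) (≡.cong (a % N ℕ.+_) (ℕ.*-comm (a / N) N))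
      ζ^[1+r]≈1 : pow R ζ (suc r) ≈ 1#
      ζ^[1+r]≈1 = begin
        pow R ζ (suc r)                   ≡⟨ ≡.trans (pow≡^ ζ (suc r)) (≡.cong (ζ ^_) (≡.sym a%N≡r)) ⟩
        ζ ^ (a % N)                       ≈⟨ sym (^-+N* (a % N) (a / N)) ⟩
        ζ ^ (a % N ℕ.+ N ℕ.* (a / N))     ≡⟨ ≡.cong (ζ ^_) (≡.sym a≡a%N+N*a/N) ⟩
        ζ ^ a                             ≈⟨ ζ^a≈1 ⟩
        1#                                ∎

    ∑-character-∣ : ∀ a → N ∣ a → ∑[ l < N ] ((ζ ^ a) ^ toℕ l) ≈ natR R N
    ∑-character-∣ a (divides c a≡cN) = begin
      ∑[ l < N ] ((ζ ^ a) ^ toℕ l)   ≈⟨ sum-cong-≋ {N} (λ l → trans (^-congˡ (toℕ l) ζ^a≈1) (1^n≈1 (toℕ l))) ⟩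
      ∑[ l < N ] 1#                  ≈⟨ ∑1≈natR N ⟩
      natR R N                       ∎
      where
      ζ^a≈1 : ζ ^ a ≈ 1#
      ζ^a≈1 = trans (reflexive (≡.cong (ζ ^_) (≡.trans a≡cN (ℕ.*-comm c N)))) (ζ^[N*c]≈1 c)

    ∑-character-∤ : IsIntegralDomain R → ∀ a → ¬ N ∣ a → ∑[ l < N ] ((ζ ^ a) ^ toℕ l) ≈ 0#
    ∑-character-∤ domain a N∤a = ∑-powers-root-of-unity domain N [ζ^a]^N≈1 (N∤a ∘ ^≈1⇒∣ a)
      where
      [ζ^a]^N≈1 : (ζ ^ a) ^ N ≈ 1#
      [ζ^a]^N≈1 = trans (^-assocʳ ζ a N) (trans (reflexive (≡.cong (ζ ^_) (ℕ.*-comm a N))) (ζ^[N*c]≈1 a))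

  ramanujanMatrix : (N Q : ℕ) → Carrier → Matrix R N
  ramanujanMatrix N Q ζ m n = sumℕ R Q (λ i → ramanujan R N ζ (suc i) (+ toℕ m ℤ.- + toℕ n))

  module Ramanujan (domain : IsIntegralDomain R) {N′ : ℕ} {ζ : Carrier}
                   (ζ-primitive : IsPrimitiveRoot R (suc N′) ζ) (Q : ℕ) (divides-N : ∀ {q} → 0 < q → q ≤ Q → q ∣ suc N′) where

    N : ℕ
    N = suc N′

    open PrimitiveRoot ζ-primitive
    open PairSum {Q} (suc ∘ toℕ)

    -- The pair (i , k) stands for the fraction (k + 1) / (i + 1).
    numerator denominator exponent : Pair → ℕ
    numerator   (_ , k) = suc (toℕ k)
    denominator (i , _) = suc (toℕ i)
    exponent p = numerator p ℕ.* (N / denominator p)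

    reduced : Pair → Bool
    reduced p = gcd (numerator p) (denominator p) ≡ᵇ 1

    -- ζ ^ N′ = ζ⁻¹, so dual e n stands for ζ^(-e n).
    character dual : ℕ → Fin N → Carrier
    character e l = ζ ^ (e ℕ.* toℕ l)
    dual      e l = ζ ^ (e ℕ.* (N′ ℕ.* toℕ l))

    open OuterSum (suc ∘ toℕ) reduced (character ∘ exponent) (dual ∘ exponent)

    denominator∣N : ∀ p → denominator p ∣ N
    denominator∣N (i , _) = divides-N z<s (Fin.toℕ<n i)

    zpow≈character*dual : ∀ e m n → zpow R N ζ (+ e ℤ.* (+ toℕ m ℤ.- + toℕ n)) ≈ character e m * dual e n
    zpow≈character*dual e m n = begin
      pow R ζ (z %ℕ N)                               ≡⟨ pow≡^ ζ (z %ℕ N) ⟩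
      ζ ^ (z %ℕ N)                                   ≈⟨ sym (^-≡-mod _ (z %ℕ N) t (exponent-congruence e (toℕ m) (toℕ n) N′)) ⟩
      ζ ^ (e ℕ.* toℕ m ℕ.+ e ℕ.* (N′ ℕ.* toℕ n))    ≈⟨ ^-homo-* ζ (e ℕ.* toℕ m) _ ⟩
      character e m * dual e n                       ∎
      where
      z = + e ℤ.* (+ toℕ m ℤ.- + toℕ n)
      t = z /ℕ N ℤ.+ + (e ℕ.* toℕ n)

    ramanujanMatrix≈outerSum : ∀ m n → ramanujanMatrix N Q ζ m n ≈ outerSum m n
    ramanujanMatrix≈outerSum m n = trans (sumℕ≈∑ Q _) (sum-cong-≋ {Q} (λ i →
      trans (sumℕ≈∑ (suc (toℕ i)) _) (sum-cong-≋ {suc (toℕ i)} (λ k → term (i , k)))))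
      where
      term : ∀ p → (if reduced p then zpow R N ζ (+ exponent p ℤ.* (+ toℕ m ℤ.- + toℕ n)) else 0#)
                   ≈ (if reduced p then character (exponent p) m * dual (exponent p) n else 0#)
      term p with reduced p
      ... | true  = zpow≈character*dual (exponent p) m n
      ... | false = refl

    reduced⇒coprime : ∀ p → T (reduced p) → Coprime (numerator p) (denominator p)
    reduced⇒coprime p r = gcd≡1⇒coprime (ℕ.≡ᵇ⇒≡ _ 1 r)

    0<exponent : ∀ p → 0 < exponent p
    0<exponent p = 0<*[/] (denominator∣N p) {numerator p} z<s

    exponent≤N : ∀ p → exponent p ≤ N
    exponent≤N p@(_ , k) = *[/]≤ (denominator∣N p) (Fin.toℕ<n k)

    exponent-injective : ∀ p p′ → T (reduced p) → T (reduced p′) → exponent p ≡ exponent p′ → p ≡ p′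
    exponent-injective p@(i , k) p′@(i′ , k′) r r′ e≡e′
      with *[/]-reduced-injective (denominator∣N p) (denominator∣N p′)
                                  (reduced⇒coprime p r) (reduced⇒coprime p′ r′) e≡e′
    ... | q≡q′ , k≡k′ with Fin.toℕ-injective (ℕ.suc-injective q≡q′)
    ... | ≡.refl = ≡.cong (i ,_) (Fin.toℕ-injective (ℕ.suc-injective k≡k′))

    N∣e*N′+e : ∀ e → N ∣ e ℕ.* N′ ℕ.+ e
    N∣e*N′+e e = divides e (≡.trans (ℕ.+-comm _ e) (≡.sym (ℕ.*-suc e N′)))

    ⟨dual,character⟩ : ∀ e e′ → ⟨ dual e , character e′ ⟩ ≈ ∑[ l < N ] ((ζ ^ (e ℕ.* N′ ℕ.+ e′)) ^ toℕ l)
    ⟨dual,character⟩ e e′ = sum-cong-≋ {N} (λ l → begin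
      ζ ^ (e ℕ.* (N′ ℕ.* toℕ l)) * ζ ^ (e′ ℕ.* toℕ l)   ≈⟨ sym (^-homo-* ζ (e ℕ.* (N′ ℕ.* toℕ l)) _) ⟩
      ζ ^ (e ℕ.* (N′ ℕ.* toℕ l) ℕ.+ e′ ℕ.* toℕ l)       ≡⟨ ≡.cong (ζ ^_) (factor e N′ (toℕ l) e′) ⟩
      ζ ^ ((e ℕ.* N′ ℕ.+ e′) ℕ.* toℕ l)                 ≈⟨ sym (^-assocʳ ζ (e ℕ.* N′ ℕ.+ e′) (toℕ l)) ⟩
      (ζ ^ (e ℕ.* N′ ℕ.+ e′)) ^ toℕ l                   ∎)
      where
      factor : ∀ e N′ l e′ → e ℕ.* (N′ ℕ.* l) ℕ.+ e′ ℕ.* l ≡ (e ℕ.* N′ ℕ.+ e′) ℕ.* l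
      factor = ℕ-Solver.solve-∀

    orthogonal : ∀ p p′ → T (reduced p) → T (reduced p′) → p ≢ p′ →
                 ⟨ dual (exponent p) , character (exponent p′) ⟩ ≈ 0#
    orthogonal p p′ r r′ p≢p′ =
      trans (⟨dual,character⟩ e e′) (∑-character-∤ domain (e ℕ.* N′ ℕ.+ e′) (p≢p′ ∘ exponent-injective p p′ r r′ ∘ e≡e′))
      where
      e e′ : ℕ
      e  = exponent p
      e′ = exponent p′
      e≡e′ : N ∣ e ℕ.* N′ ℕ.+ e′ → e ≡ e′
      e≡e′ = ∣m+n∣m+o⇒n≡o {m = e ℕ.* N′} (0<exponent p) (exponent≤N p) (0<exponent p′) (exponent≤N p′)
                          (N∣e*N′+e e)

    normalised : ∀ p → T (reduced p) → ⟨ dual (exponent p) , character (exponent p) ⟩ ≈ natR R N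
    normalised p _ = trans (⟨dual,character⟩ e e) (∑-character-∣ (e ℕ.* N′ ℕ.+ e) (N∣e*N′+e e))
      where e = exponent p

    ramanujanMatrix-square : ∀ m n → (_·_ R (ramanujanMatrix N Q ζ) (ramanujanMatrix N Q ζ)) m n
                                     ≈ natR R N * ramanujanMatrix N Q ζ m n
    ramanujanMatrix-square m n = begin
      (_·_ R X X) m n                ≈⟨ ·-cong ramanujanMatrix≈outerSum ramanujanMatrix≈outerSum m n ⟩
      (_·_ R outerSum outerSum) m n  ≈⟨ outerSum-square (natR R N) orthogonal normalised m n ⟩
      natR R N * outerSum m n        ≈⟨ *-congˡ (sym (ramanujanMatrix≈outerSum m n)) ⟩
      natR R N * X m n               ∎
      where X = ramanujanMatrix N Q ζ

  ramanujanMatrix-power : IsIntegralDomain R → ∀ {N ζ} → IsPrimitiveRoot R N ζ →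
                          ∀ Q → (∀ {q} → 0 < q → q ≤ Q → q ∣ N) →
                          ∀ j m n → mpow R (ramanujanMatrix N Q ζ) (suc j) m n
                                    ≈ pow R (natR R N) j * ramanujanMatrix N Q ζ m n
  ramanujanMatrix-power domain {zero}   _           _ _         _ ()
  ramanujanMatrix-power domain {suc N′} ζ-primitive Q divides-N =
    mpow-suc _ _ (Ramanujan.ramanujanMatrix-square domain ζ-primitive Q divides-N)

∣lcmUpTo : ∀ Q {q} → 0 < q → q ≤ Q → q ∣ lcmUpTo Q
∣lcmUpTo zero    z<s ()
∣lcmUpTo (suc Q) 0<q q≤1+Q with ℕ.m≤n⇒m<n∨m≡n q≤1+Q
... | inj₁ q<1+Q  = ∣-trans (∣lcmUpTo Q 0<q (ℕ.≤-pred q<1+Q)) (n∣lcm[m,n] (suc Q) (lcmUpTo Q))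
... | inj₂ ≡.refl = m∣lcm[m,n] (suc Q) (lcmUpTo Q)

lemma7 : {c ℓ : Level} (R : CommutativeRing c ℓ) → IsIntegralDomain R →
    (ζ : CommutativeRing.Carrier R) → (Q : ℕ) → 1 ≤ Q →
    IsPrimitiveRoot R (lcmUpTo Q) ζ →
    (j : ℕ) → 2 ≤ j → (m n : Fin (lcmUpTo Q)) →
    CommutativeRing._≈_ R (mpow R (Xmat R Q ζ) j m n)
      (CommutativeRing._*_ R (pow R (natR R (lcmUpTo Q)) (j ∸ 1)) (Xmat R Q ζ m n))
lemma7 R domain ζ Q _ ζ-primitive (suc zero)    (s≤s ())
lemma7 R domain ζ Q _ ζ-primitive (suc (suc j)) _ =
  ramanujanMatrix-power R domain ζ-primitive Q (∣lcmUpTo Q) (suc j)
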